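{- For every positive integer $k$ there are integers $m,n<2k^2$ and matrices $A\in\{0,\pm 1\}^{m\times n}$ and $W\in\mathbb{Z}_+^{2\times n}$ with $\log \|W\|_\infty <2k$, such that the projection by $W$ of the $\{0,1\}$-polytope $Q:={\rm conv}\{x\in\mathbb{Z}^n : Ax=0,\ 0\le x\le 1\}$ into the plane $\mathbb{R}^2$ (i.e., $\{Wx : x\in Q\}$) has exactly $2^k$ vertices.
   Context: $\|W\|_\infty:=\max_{i,j}|W_{i,j}|$; the inequalities $0\le x\le 1$ are componentwise. -}

module Defs where

open import Data.Nat as ℕ using (ℕ)
open import Data.Fin using (Fin; zero; suc)
open import Data.Integer using (ℤ; _+_; _*_; _≤_; _<_; +_; 0ℤ; 1ℤ; -1ℤ)
open import Data.Product using (_×_; _,_; ∃-syntax)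
open import Data.Sum using (_⊎_)
open import Relation.Binary.PropositionalEquality using (_≡_; _≢_)

sumℤ : ∀ {n} → (Fin n → ℤ) → ℤ
sumℤ {ℕ.zero}  f = 0ℤ
sumℤ {ℕ.suc n} f = f zero + sumℤ (λ i → f (suc i))

SignMatrix : ∀ {m n} → (Fin m → Fin n → ℤ) → Set
SignMatrix A = ∀ i j → A i j ≡ 0ℤ ⊎ A i j ≡ 1ℤ ⊎ A i j ≡ -1ℤ

Feasible : ∀ {m n} → (Fin m → Fin n → ℤ) → (Fin n → ℤ) → Set
Feasible A x = (∀ i → sumℤ (λ j → A i j * x j) ≡ 0ℤ)
             × (∀ j → 0ℤ ≤ x j × x j ≤ 1ℤ)

project : ∀ {n} → (Fin 2 → Fin n → ℕ) → (Fin n → ℤ) → ℤ × ℤ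
project W x = sumℤ (λ j → + W zero j * x j) , sumℤ (λ j → + W (suc zero) j * x j)

dot : ℤ × ℤ → ℤ × ℤ → ℤ
dot (c₁ , c₂) (p₁ , p₂) = c₁ * p₁ + c₂ * p₂

-- p is a vertex of W·conv{x : Feasible A x} = conv{W x : Feasible A x}:
-- p is one of the generating points W x and is the unique maximiser over
-- them of some linear functional c (integer c suffices, by rational density
-- and scaling, since all points are integral).
IsVertex : ∀ {m n} → (Fin m → Fin n → ℤ) → (Fin 2 → Fin n → ℕ) → ℤ × ℤ → Set
IsVertex A W p =
  (∃[ x ] (Feasible A x × project W x ≡ p))
  × (∃[ c ] (∀ x → Feasible A x → project W x ≢ p → dot c (project W x) < dot c p))

{-# OPTIONS --safe #-}
module Submission where

-- Write t = Σⱼ 2ʲ bⱼ for 0/1 variables b₀ … b_{k-1}. The system A_{k+1} is A_k plus a new least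
-- significant bit a, so that t becomes a + 2t, together with one gadget per old bit bⱼ whose
-- 0/1 columns are forced to contain the product a bⱼ (a half adder: a + bⱼ = 2 (a bⱼ) + (a ⊕ bⱼ)).
-- The first row of W reads off t; the second is built recursively as a + 4 Σⱼ 2ʲ (a bⱼ) + 4 t² =
-- (a + 2t)², so every feasible point projects to (t, t²), and every t < 2ᵏ is attained. Points on
-- the parabola are in convex position, the tangent functional (2t, -1) separating (t, t²) from all
-- the others, so the projection has exactly the 2ᵏ vertices (t, t²).

module Vectors where

  open import Data.Nat as ℕ using (ℕ; zero; suc)
  open import Data.Fin using (Fin; zero; suc; splitAt; _↑ˡ_; _↑ʳ_)
  open import Data.Integer using (ℤ; +_; 0ℤ; _+_; _*_)
  open import Data.Integer.Properties
    using (+-identityˡ; +-identityʳ; +-assoc; *-zeroʳ; *-zeroˡ; *-distribˡ-+; *-assoc; pos-*; *-commutativeSemigroup)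
  open import Algebra.Properties.CommutativeSemigroup *-commutativeSemigroup using (x∙yz≈y∙xz)
  open import Data.Sum using (inj₁; inj₂)
  open import Data.Sum.Properties using ([,]-∘)
  open import Data.Vec.Functional using (Vector; _∷_; _++_; map; take; drop; replicate)
  open import Data.Vec.Functional.Properties using (lookup-++ˡ; lookup-++ʳ)
  open import Relation.Binary.PropositionalEquality
  open import Defs using (sumℤ)

  private variable
    m n : ℕ

  all-++⁺ : ∀ {A : Set} {P : A → Set} {u : Vector A m} {v : Vector A n} →
    (∀ i → P (u i)) → (∀ i → P (v i)) → ∀ i → P ((u ++ v) i)
  all-++⁺ {m} pu pv i with splitAt m i
  ... | inj₁ i′ = pu i′
  ... | inj₂ i′ = pv i′

  all-++⁻ˡ : ∀ {A : Set} (P : A → Set) (u : Vector A m) (v : Vector A n) →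
    (∀ i → P ((u ++ v) i)) → ∀ i → P (u i)
  all-++⁻ˡ {n = n} P u v p i = subst P (lookup-++ˡ u v i) (p (i ↑ˡ n))

  all-++⁻ʳ : ∀ {A : Set} (P : A → Set) (u : Vector A m) (v : Vector A n) →
    (∀ i → P ((u ++ v) i)) → ∀ i → P (v i)
  all-++⁻ʳ {m} P u v p i = subst P (lookup-++ʳ u v i) (p (m ↑ʳ i))

  sumℤ-cong : {f g : Vector ℤ n} → (∀ i → f i ≡ g i) → sumℤ f ≡ sumℤ g
  sumℤ-cong {zero}  f≗g = refl
  sumℤ-cong {suc n} f≗g = cong₂ _+_ (f≗g zero) (sumℤ-cong (λ i → f≗g (suc i)))

  sumℤ-++ : ∀ m (f : Vector ℤ (m ℕ.+ n)) → sumℤ f ≡ sumℤ (take m f) + sumℤ (drop m f)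
  sumℤ-++ zero    f = sym (+-identityˡ _)
  sumℤ-++ (suc m) f = trans (cong (_+_ (f zero)) (sumℤ-++ m (λ i → f (suc i))))
                            (sym (+-assoc (f zero) _ _))

  sumℤ-scale : ∀ c (f : Vector ℤ n) → sumℤ (λ i → c * f i) ≡ c * sumℤ f
  sumℤ-scale {zero}  c f = sym (*-zeroʳ c)
  sumℤ-scale {suc n} c f = trans (cong (_+_ (c * f zero)) (sumℤ-scale c (λ i → f (suc i))))
                                 (sym (*-distribˡ-+ c _ _))

  infix 7 _·_

  _·_ : Vector ℤ n → Vector ℤ n → ℤ
  u · x = sumℤ (λ i → u i * x i)

  ⟪_,_⟫ : Vector ℕ n → Vector ℤ n → ℤ
  ⟪ w , x ⟫ = map +_ w · x

  zeros : Vector ℤ n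
  zeros = replicate _ 0ℤ

  ·-congˡ : {u v : Vector ℤ n} (x : Vector ℤ n) → (∀ i → u i ≡ v i) → u · x ≡ v · x
  ·-congˡ x u≗v = sumℤ-cong (λ i → cong (_* x i) (u≗v i))

  ·-congʳ : (u : Vector ℤ n) {x y : Vector ℤ n} → (∀ i → x i ≡ y i) → u · x ≡ u · y
  ·-congʳ u x≗y = sumℤ-cong (λ i → cong (u i *_) (x≗y i))

  ·-++ : ∀ (u : Vector ℤ m) (v : Vector ℤ n) x → (u ++ v) · x ≡ u · take m x + v · drop m x
  ·-++ {m} u v x = trans (sumℤ-++ m _)
    (cong₂ _+_ (·-congˡ (take m x) (lookup-++ˡ u v)) (·-congˡ (drop m x) (lookup-++ʳ u v)))

  zeros-· : (x : Vector ℤ n) → zeros · x ≡ 0ℤ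
  zeros-· x = trans (sumℤ-scale 0ℤ x) (*-zeroˡ (sumℤ x))

  ·-map-* : ∀ (u : Vector ℤ n) c x → u · map (c *_) x ≡ c * (u · x)
  ·-map-* u c x = trans (sumℤ-cong (λ i → x∙yz≈y∙xz (u i) c (x i))) (sumℤ-scale c (λ i → u i * x i))

  ⟪⟫-++ : ∀ (u : Vector ℕ m) (v : Vector ℕ n) x → ⟪ u ++ v , x ⟫ ≡ ⟪ u , take m x ⟫ + ⟪ v , drop m x ⟫
  ⟪⟫-++ {m} u v x = trans (·-congˡ x (λ i → [,]-∘ +_ (splitAt m i))) (·-++ (map +_ u) (map +_ v) x)

  ⟪⟫-map-* : ∀ c (w : Vector ℕ n) x → ⟪ map (c ℕ.*_) w , x ⟫ ≡ + c * ⟪ w , x ⟫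
  ⟪⟫-map-* c w x = trans (sumℤ-cong (λ i → trans (cong (_* x i) (pos-* c (w i))) (*-assoc (+ c) _ _)))
                         (sumℤ-scale (+ c) (λ i → + w i * x i))

  unit : ℤ → Fin n → Vector ℤ n
  unit c zero    = c ∷ zeros
  unit c (suc j) = 0ℤ ∷ unit c j

  unit-· : ∀ c (j : Fin n) x → unit c j · x ≡ c * x j
  unit-· c zero    x = trans (cong (_+_ (c * x zero)) (zeros-· (λ i → x (suc i)))) (+-identityʳ _)
  unit-· c (suc j) x = trans (cong (_+ unit c j · (λ i → x (suc i))) (*-zeroˡ (x zero)))
                             (trans (+-identityˡ _) (unit-· c j (λ i → x (suc i))))

  unit-entries : ∀ {P : ℤ → Set} {c} (j : Fin n) → P c → P 0ℤ → ∀ i → P (unit c j i)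
  unit-entries zero    pc p0 zero    = pc
  unit-entries zero    pc p0 (suc i) = p0
  unit-entries (suc j) pc p0 zero    = p0
  unit-entries {P = P} (suc j) pc p0 (suc i) = unit-entries {P = P} j pc p0 i


module Binary where

  open import Data.Nat as ℕ using (ℕ; zero; suc; _^_; z≤n; s≤s)
  import Data.Nat.Properties as ℕ
  open import Data.Nat.DivMod using (_%_; _/_; m%n<n; m≡m%n+[m/n]*n; m<n*o⇒m/o<n)
  open import Data.Fin using (Fin; zero; suc)
  open import Data.Integer using (ℤ; +_; -[1+_]; 0ℤ; 1ℤ; _+_; _*_; _≤_; +≤+)
  open import Data.Integer.Properties using (*-identityˡ; +-identityˡ; pos-*)
  open import Data.Product using (_×_; _,_; ∃-syntax)
  open import Data.Vec.Functional using (Vector; []; _∷_; map; tail)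
  open import Relation.Binary.PropositionalEquality
  open ≡-Reasoning
  open Vectors

  data Bit : ℤ → Set where
    bit0 : Bit 0ℤ
    bit1 : Bit 1ℤ

  Bit⇒bounds : ∀ {v} → Bit v → 0ℤ ≤ v × v ≤ 1ℤ
  Bit⇒bounds bit0 = +≤+ z≤n , +≤+ z≤n
  Bit⇒bounds bit1 = +≤+ z≤n , +≤+ (s≤s z≤n)

  bounds⇒Bit : ∀ {v} → 0ℤ ≤ v → v ≤ 1ℤ → Bit v
  bounds⇒Bit {+ zero}        _ _              = bit0
  bounds⇒Bit {+ suc zero}    _ _              = bit1
  bounds⇒Bit {+ suc (suc _)} _ (+≤+ (s≤s ()))
  bounds⇒Bit { -[1+ _ ]}     () _

  twoPowers : ∀ k → Vector ℕ k
  twoPowers zero    = []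
  twoPowers (suc k) = 1 ∷ map (2 ℕ.*_) (twoPowers k)

  twoPowers-< : ∀ k (j : Fin k) → twoPowers k j ℕ.< 2 ^ k
  twoPowers-< (suc k) zero    = ℕ.*-monoʳ-≤ 2 (ℕ.m^n>0 2 k)
  twoPowers-< (suc k) (suc j) = ℕ.*-monoʳ-< 2 (twoPowers-< k j)

  binary : ∀ {k} → Vector ℤ k → ℤ
  binary b = ⟪ twoPowers _ , b ⟫

  binary-∷ : ∀ {k} (b : Vector ℤ (suc k)) → binary b ≡ b zero + + 2 * binary (tail b)
  binary-∷ {k} b = cong₂ _+_ (*-identityˡ (b zero)) (⟪⟫-map-* 2 (twoPowers k) (tail b))

  binary-< : ∀ {k} (b : Vector ℤ k) → (∀ i → Bit (b i)) → ∃[ t ] (binary b ≡ + t × t ℕ.< 2 ^ k)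
  binary-< {zero}  b _     = 0 , refl , s≤s z≤n
  binary-< {suc k} b b-bit with binary-< (tail b) (λ i → b-bit (suc i))
  ... | t , eq , t<2ᵏ = prepend (b-bit zero) (trans (binary-∷ b) (cong (λ z → b zero + + 2 * z) eq))
    where
      prepend : ∀ {a} → Bit a → binary b ≡ a + + 2 * + t → ∃[ t′ ] (binary b ≡ + t′ × t′ ℕ.< 2 ^ suc k)
      prepend bit0 eq′ = 2 ℕ.* t , trans eq′ (trans (+-identityˡ _) (sym (pos-* 2 t))) ,
        ℕ.*-monoʳ-< 2 t<2ᵏ
      prepend bit1 eq′ = suc (2 ℕ.* t) , trans eq′ (cong (_+_ 1ℤ) (sym (pos-* 2 t))) ,
        ℕ.≤-trans (ℕ.≤-reflexive (sym (ℕ.*-suc 2 t))) (ℕ.*-monoʳ-≤ 2 t<2ᵏ)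

  digits : ∀ k → ℕ → Vector ℤ k
  digits zero    t = []
  digits (suc k) t = + (t % 2) ∷ digits k (t / 2)

  digits-Bit : ∀ k t (i : Fin k) → Bit (digits k t i)
  digits-Bit (suc k) t zero    = bounds⇒Bit (+≤+ z≤n) (+≤+ (ℕ.≤-pred (m%n<n t 2)))
  digits-Bit (suc k) t (suc i) = digits-Bit k (t / 2) i

  binary-digits : ∀ k t → t ℕ.< 2 ^ k → binary (digits k t) ≡ + t
  binary-digits zero    zero    _ = refl
  binary-digits zero    (suc t) (s≤s ())
  binary-digits (suc k) t t<2ᵏ⁺¹ = begin
    binary (digits (suc k) t)                    ≡⟨ binary-∷ (digits (suc k) t) ⟩
    + (t % 2) + + 2 * binary (digits k (t / 2))  ≡⟨ cong (λ z → + (t % 2) + + 2 * z) (binary-digits k (t / 2) t/2<2ᵏ) ⟩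
    + (t % 2) + + 2 * + (t / 2)                  ≡⟨ cong (_+_ (+ (t % 2))) (pos-* 2 (t / 2)) ⟨
    + (t % 2 ℕ.+ 2 ℕ.* (t / 2))                  ≡⟨ cong +_ divMod ⟨
    + t                                          ∎
    where
      t/2<2ᵏ : t / 2 ℕ.< 2 ^ k
      t/2<2ᵏ = m<n*o⇒m/o<n (subst (t ℕ.<_) (ℕ.*-comm 2 (2 ^ k)) t<2ᵏ⁺¹)
      divMod : t ≡ t % 2 ℕ.+ 2 ℕ.* (t / 2)
      divMod = trans (m≡m%n+[m/n]*n t 2) (cong (t % 2 ℕ.+_) (ℕ.*-comm (t / 2) 2))


module HalfAdder where

  open import Data.Integer using (ℤ; 0ℤ; _+_; _-_; _*_)
  open import Data.Integer.Properties using (i-j≡0⇒i≡j)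
  open import Data.Integer.Tactic.RingSolver using (solve-∀)
  open import Relation.Binary.PropositionalEquality
  open Binary

  or xor : ℤ → ℤ → ℤ
  or  a c = a + c - a * c
  xor a c = or a c - a * c

  Bit-* : ∀ {a c} → Bit a → Bit c → Bit (a * c)
  Bit-* bit0 _    = bit0
  Bit-* bit1 bit0 = bit0
  Bit-* bit1 bit1 = bit1

  Bit-or : ∀ {a c} → Bit a → Bit c → Bit (or a c)
  Bit-or bit0 bit0 = bit0
  Bit-or bit0 bit1 = bit1
  Bit-or bit1 bit0 = bit1
  Bit-or bit1 bit1 = bit1

  Bit-xor : ∀ {a c} → Bit a → Bit c → Bit (xor a c)
  Bit-xor bit0 bit0 = bit0
  Bit-xor bit0 bit1 = bit1
  Bit-xor bit1 bit0 = bit1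
  Bit-xor bit1 bit1 = bit0

  Bit-idem : ∀ {a} → Bit a → a * a ≡ a
  Bit-idem bit0 = refl
  Bit-idem bit1 = refl

  sum-and-or : ∀ a c → a + c - (a * c + or a c) ≡ 0ℤ
  sum-and-or = identity
    where
      identity : ∀ a c → a + c - (a * c + (a + c - a * c)) ≡ 0ℤ
      identity = solve-∀

  or-and-xor : ∀ a c → or a c - (a * c + xor a c) ≡ 0ℤ
  or-and-xor = identity
    where
      identity : ∀ a c → a + c - a * c - (a * c + (a + c - a * c - a * c)) ≡ 0ℤ
      identity = solve-∀

  carry-unique : ∀ {a c y s} → Bit a → Bit c → Bit y → Bit s → a + c ≡ y + (y + s) → y ≡ a * c
  carry-unique bit0 bit0 bit0 bit0 _  = refl
  carry-unique bit0 bit0 bit0 bit1 ()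
  carry-unique bit0 bit0 bit1 bit0 ()
  carry-unique bit0 bit0 bit1 bit1 ()
  carry-unique bit0 bit1 bit0 bit0 ()
  carry-unique bit0 bit1 bit0 bit1 _  = refl
  carry-unique bit0 bit1 bit1 bit0 ()
  carry-unique bit0 bit1 bit1 bit1 ()
  carry-unique bit1 bit0 bit0 bit0 ()
  carry-unique bit1 bit0 bit0 bit1 _  = refl
  carry-unique bit1 bit0 bit1 bit0 ()
  carry-unique bit1 bit0 bit1 bit1 ()
  carry-unique bit1 bit1 bit0 bit0 ()
  carry-unique bit1 bit1 bit0 bit1 ()
  carry-unique bit1 bit1 bit1 bit0 _  = refl
  carry-unique bit1 bit1 bit1 bit1 ()

  -- 2y + s = a + c has a coefficient 2, so it is split into two equations with coefficients in
  -- {0, ±1} through the auxiliary w, which itself need not be bounded.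
  equations⇒and : ∀ {a c y w s} → Bit a → Bit c → Bit y → Bit s →
    a + c - (y + w) ≡ 0ℤ → w - (y + s) ≡ 0ℤ → y ≡ a * c
  equations⇒and {y = y} a-bit c-bit y-bit s-bit sum≡ or≡ =
    carry-unique a-bit c-bit y-bit s-bit (trans (i-j≡0⇒i≡j _ _ sum≡) (cong (_+_ y) (i-j≡0⇒i≡j _ _ or≡)))


module Parabola where

  open import Data.Nat as ℕ using (ℕ; suc; s≤s; z≤n)
  open import Data.Empty using (⊥-elim)
  open import Data.Fin using (Fin; toℕ; fromℕ<)
  open import Data.Fin.Properties using (toℕ-injective; toℕ-fromℕ<; toℕ<n)
  open import Data.Integer using (ℤ; +_; -[1+_]; 0ℤ; -1ℤ; _+_; _-_; _*_; _<_; +<+)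
  open import Data.Integer.Properties using (i-j≡0⇒i≡j; +-monoʳ-<; +-identityʳ; +-injective)
  open import Data.Integer.Tactic.RingSolver using (solve-∀)
  open import Data.Product using (_×_; _,_; proj₁; ∃-syntax)
  open import Function.Bundles using (_⇔_; mk⇔)
  open import Function.Definitions using (Injective)
  open import Relation.Binary.PropositionalEquality
  open import Relation.Nullary using (¬_)
  open import Defs using (Feasible; project; dot; IsVertex)

  parabola : ℤ → ℤ × ℤ
  parabola z = z , z * z

  parabola-injective : ∀ {M} → Injective {A = Fin M} _≡_ _≡_ (λ i → parabola (+ toℕ i))
  parabola-injective eq = toℕ-injective (+-injective (cong proj₁ eq))

  square-positive : ∀ d → ¬ d ≡ 0ℤ → 0ℤ < d * d
  square-positive (+ 0)     d≢0 = ⊥-elim (d≢0 refl)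
  square-positive (+ suc n) _   = +<+ (s≤s z≤n)
  square-positive -[1+ n ]  _   = +<+ (s≤s z≤n)

  tangent : ℤ → ℤ × ℤ
  tangent t = + 2 * t , -1ℤ

  tangent-separates : ∀ t t′ → ¬ t′ ≡ t → dot (tangent t) (parabola t′) < dot (tangent t) (parabola t)
  tangent-separates t t′ t′≢t = subst₂ _<_ (+-identityʳ _) (sym (completeSquare t t′))
    (+-monoʳ-< (dot (tangent t) (parabola t′)) (square-positive (t - t′) (λ eq → t′≢t (sym (i-j≡0⇒i≡j t t′ eq)))))
    where
      completeSquare : ∀ t t′ → + 2 * t * t + -1ℤ * (t * t) ≡ (+ 2 * t * t′ + -1ℤ * (t′ * t′)) + (t - t′) * (t - t′)
      completeSquare = solve-∀

  parabola-vertices : ∀ {m n} (A : Fin m → Fin n → ℤ) (W : Fin 2 → Fin n → ℕ) M →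
    (∀ x → Feasible A x → ∃[ t ] (t ℕ.< M × project W x ≡ parabola (+ t))) →
    (∀ t → t ℕ.< M → ∃[ x ] (Feasible A x × project W x ≡ parabola (+ t))) →
    ∀ p → IsVertex A W p ⇔ (∃[ i ] parabola (+ toℕ {M} i) ≡ p)
  parabola-vertices A W M on-parabola covered p = mk⇔ vertex⇒point point⇒vertex
    where
      vertex⇒point : IsVertex A W p → ∃[ i ] parabola (+ toℕ i) ≡ p
      vertex⇒point ((x , feasible , refl) , _) with on-parabola x feasible
      ... | t , t<M , eq = fromℕ< t<M , trans (cong (λ s → parabola (+ s)) (toℕ-fromℕ< t<M)) (sym eq)

      point⇒vertex : ∃[ i ] parabola (+ toℕ i) ≡ p → IsVertex A W p
      point⇒vertex (i , refl) with covered (toℕ i) (toℕ<n i)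
      ... | x , feasible , eq = (x , feasible , eq) , tangent t , separated
        where
          t = + toℕ i
          separated : ∀ x′ → Feasible A x′ → ¬ project W x′ ≡ parabola t →
            dot (tangent t) (project W x′) < dot (tangent t) (parabola t)
          separated x′ feasible′ ne with on-parabola x′ feasible′
          ... | t′ , _ , eq′ = subst (λ q → dot (tangent t) q < dot (tangent t) (parabola t)) (sym eq′)
            (tangent-separates t (+ t′) (λ e → ne (trans eq′ (cong parabola e))))


module Construction where

  open import Data.Nat as ℕ using (ℕ; zero; suc; _^_)
  import Data.Nat.Properties as ℕ
  open import Data.Fin using (Fin; zero; suc; _↑ˡ_; _↑ʳ_)
  open import Data.Integer using (ℤ; +_; 0ℤ; 1ℤ; -1ℤ; _+_; _-_; _*_)
  open import Data.Integer.Properties using (*-identityˡ; *-zeroˡ; +-identityˡ; +-identityʳ)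
  open import Data.Integer.Tactic.RingSolver using (solve-∀)
  open import Data.Product using (_×_; _,_; proj₁; proj₂; ∃-syntax)
  open import Data.Sum using (_⊎_; inj₁; inj₂)
  open import Data.Vec.Functional using (Vector; []; _∷_; _++_; map; take; drop; replicate; head; tail)
  open import Data.Vec.Functional.Properties using (lookup-++ʳ; lookup-++ˡ)
  open import Relation.Binary.PropositionalEquality
  open ≡-Reasoning
  open import Defs using (Feasible; SignMatrix; project)
  open Vectors
  open Binary
  open HalfAdder
  open Parabola using (parabola)

  gadgetCols : ℕ → ℕ
  gadgetCols k = k ℕ.+ (k ℕ.+ k)

  cols : ℕ → ℕ
  cols zero    = 0
  cols (suc k) = suc (gadgetCols k ℕ.+ cols k)

  rows : ℕ → ℕ
  rows zero    = 0
  rows (suc k) = (k ℕ.+ k) ℕ.+ rows k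

  -- The columns of level k + 1: the new bit a, then per old bit bⱼ the carry yⱼ = a bⱼ,
  -- wⱼ = a ∨ bⱼ and the sum sⱼ = a ⊕ bⱼ of the half adder a + bⱼ, then the columns of level k.
  assemble : ∀ {k} → ℤ → (y w s : Vector ℤ k) → Vector ℤ (cols k) → Vector ℤ (cols (suc k))
  assemble a y w s o = a ∷ ((y ++ (w ++ s)) ++ o)

  module _ (k : ℕ) (x : Vector ℤ (cols (suc k))) where

    gadgetPart : Vector ℤ (gadgetCols k)
    gadgetPart = take (gadgetCols k) (tail x)

    oldPart : Vector ℤ (cols k)
    oldPart = drop (gadgetCols k) (tail x)

    andPart orPart xorPart : Vector ℤ k
    andPart = take k gadgetPart
    orPart  = take k (drop k gadgetPart)
    xorPart = drop k (drop k gadgetPart)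

  module _ {k : ℕ} (a : ℤ) (y w s : Vector ℤ k) (o : Vector ℤ (cols k)) where

    andPart-assemble : ∀ j → andPart k (assemble a y w s o) j ≡ y j
    andPart-assemble j = trans (lookup-++ˡ (y ++ (w ++ s)) o _) (lookup-++ˡ y (w ++ s) j)

    orPart-assemble : ∀ j → orPart k (assemble a y w s o) j ≡ w j
    orPart-assemble j = trans (lookup-++ˡ (y ++ (w ++ s)) o _)
      (trans (lookup-++ʳ y (w ++ s) _) (lookup-++ˡ w s j))

    xorPart-assemble : ∀ j → xorPart k (assemble a y w s o) j ≡ s j
    xorPart-assemble j = trans (lookup-++ˡ (y ++ (w ++ s)) o _)
      (trans (lookup-++ʳ y (w ++ s) _) (lookup-++ʳ w s j))

    oldPart-assemble : ∀ c → oldPart k (assemble a y w s o) c ≡ o c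
    oldPart-assemble = lookup-++ʳ (y ++ (w ++ s)) o

    assemble-entries : ∀ {P : ℤ → Set} → P a → (∀ i → P (y i)) → (∀ i → P (w i)) → (∀ i → P (s i)) →
      (∀ i → P (o i)) → ∀ c → P (assemble a y w s o c)
    assemble-entries pa py pw ps po zero    = pa
    assemble-entries {P} pa py pw ps po (suc c) =
      all-++⁺ {P = P} {u = y ++ (w ++ s)} {v = o}
        (all-++⁺ {P = P} {u = y} {v = w ++ s} py (all-++⁺ {P = P} {u = w} {v = s} pw ps)) po c

  ·-assemble : ∀ {k} c (u v t : Vector ℤ k) (r : Vector ℤ (cols k)) x →
    assemble c u v t r · x ≡ c * head x + ((u · andPart k x + (v · orPart k x + t · xorPart k x)) + r · oldPart k x)
  ·-assemble {k} c u v t r x = cong (_+_ (c * head x)) (begin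
    ((u ++ (v ++ t)) ++ r) · tail x
      ≡⟨ ·-++ (u ++ (v ++ t)) r (tail x) ⟩
    (u ++ (v ++ t)) · gadgetPart k x + r · oldPart k x
      ≡⟨ cong (_+ r · oldPart k x) (·-++ u (v ++ t) (gadgetPart k x)) ⟩
    (u · andPart k x + (v ++ t) · drop k (gadgetPart k x)) + r · oldPart k x
      ≡⟨ cong (λ z → (u · andPart k x + z) + r · oldPart k x) (·-++ v t (drop k (gadgetPart k x))) ⟩
    (u · andPart k x + (v · orPart k x + t · xorPart k x)) + r · oldPart k x ∎)

  bit : ∀ k → Fin k → Fin (cols k)
  bit (suc k) zero    = zero
  bit (suc k) (suc j) = suc (gadgetCols k ↑ʳ bit k j)

  bits : ∀ k → Vector ℤ (cols k) → Vector ℤ k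
  bits k x j = x (bit k j)

  sumRow diffRow : ∀ k → Fin k → Vector ℤ (cols (suc k))
  sumRow  k j = assemble 1ℤ (unit -1ℤ j) (unit -1ℤ j) zeros (unit 1ℤ (bit k j))
  diffRow k j = assemble 0ℤ (unit -1ℤ j) (unit 1ℤ j) (unit -1ℤ j) zeros

  lift : ∀ {k} → Vector ℤ (cols k) → Vector ℤ (cols (suc k))
  lift r = 0ℤ ∷ (zeros ++ r)

  A : ∀ k → Fin (rows k) → Fin (cols k) → ℤ
  A zero    = []
  A (suc k) = (sumRow k ++ diffRow k) ++ map lift (A k)

  sumRow-· : ∀ k j x → sumRow k j · x ≡ head x + bits k (oldPart k x) j - (andPart k x j + orPart k x j)
  sumRow-· k j x = begin
    sumRow k j · x
      ≡⟨ ·-assemble 1ℤ (unit -1ℤ j) (unit -1ℤ j) zeros (unit 1ℤ (bit k j)) x ⟩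
    1ℤ * a + ((unit -1ℤ j · andPart k x + (unit -1ℤ j · orPart k x + zeros · xorPart k x))
              + unit 1ℤ (bit k j) · oldPart k x)
      ≡⟨ cong₂ (λ p q → 1ℤ * a + (p + q))
           (cong₂ _+_ (unit-· -1ℤ j (andPart k x)) (cong₂ _+_ (unit-· -1ℤ j (orPart k x)) (zeros-· (xorPart k x))))
           (unit-· 1ℤ (bit k j) (oldPart k x)) ⟩
    1ℤ * a + ((-1ℤ * y + (-1ℤ * w + 0ℤ)) + 1ℤ * c)
      ≡⟨ normalise a y w c ⟩
    a + c - (y + w) ∎
    where
      a = head x
      c = bits k (oldPart k x) j
      y = andPart k x j
      w = orPart k x j
      normalise : ∀ a y w c → 1ℤ * a + ((-1ℤ * y + (-1ℤ * w + 0ℤ)) + 1ℤ * c) ≡ a + c - (y + w)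
      normalise = solve-∀

  diffRow-· : ∀ k j x → diffRow k j · x ≡ orPart k x j - (andPart k x j + xorPart k x j)
  diffRow-· k j x = begin
    diffRow k j · x
      ≡⟨ ·-assemble 0ℤ (unit -1ℤ j) (unit 1ℤ j) (unit -1ℤ j) zeros x ⟩
    0ℤ * a + ((unit -1ℤ j · andPart k x + (unit 1ℤ j · orPart k x + unit -1ℤ j · xorPart k x))
              + zeros · oldPart k x)
      ≡⟨ cong₂ (λ p q → 0ℤ * a + (p + q))
           (cong₂ _+_ (unit-· -1ℤ j (andPart k x)) (cong₂ _+_ (unit-· 1ℤ j (orPart k x)) (unit-· -1ℤ j (xorPart k x))))
           (zeros-· (oldPart k x)) ⟩
    0ℤ * a + ((-1ℤ * y + (1ℤ * w + -1ℤ * s)) + 0ℤ)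
      ≡⟨ normalise a y w s ⟩
    w - (y + s) ∎
    where
      a = head x
      y = andPart k x j
      w = orPart k x j
      s = xorPart k x j
      normalise : ∀ a y w s → 0ℤ * a + ((-1ℤ * y + (1ℤ * w + -1ℤ * s)) + 0ℤ) ≡ w - (y + s)
      normalise = solve-∀

  lift-· : ∀ k (r : Vector ℤ (cols k)) x → lift r · x ≡ r · oldPart k x
  lift-· k r x = begin
    0ℤ * head x + (zeros ++ r) · tail x              ≡⟨ cong₂ _+_ (*-zeroˡ (head x)) (·-++ zeros r (tail x)) ⟩
    0ℤ + (zeros · gadgetPart k x + r · oldPart k x)  ≡⟨ +-identityˡ _ ⟩
    zeros · gadgetPart k x + r · oldPart k x         ≡⟨ cong (_+ r · oldPart k x) (zeros-· (gadgetPart k x)) ⟩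
    0ℤ + r · oldPart k x                             ≡⟨ +-identityˡ _ ⟩
    r · oldPart k x                                  ∎

  IsSign : ℤ → Set
  IsSign z = z ≡ 0ℤ ⊎ z ≡ 1ℤ ⊎ z ≡ -1ℤ

  A-sign : ∀ k → SignMatrix (A k)
  A-sign zero    ()
  A-sign (suc k) = all-++⁺ {P = SignRow} {u = sumRow k ++ diffRow k} {v = map lift (A k)}
    (all-++⁺ {P = SignRow} {u = sumRow k} {v = diffRow k} sumRow-sign diffRow-sign)
    (λ r → lift-sign (A-sign k r))
    where
      SignRow : Vector ℤ (cols (suc k)) → Set
      SignRow row = ∀ c → IsSign (row c)
      0± 1± -1± : IsSign _
      0±  = inj₁ refl
      1±  = inj₂ (inj₁ refl)
      -1± = inj₂ (inj₂ refl)
      unit-sign : ∀ {n c} (j : Fin n) → IsSign c → ∀ i → IsSign (unit c j i)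
      unit-sign j c± = unit-entries {P = IsSign} j c± 0±
      sumRow-sign : ∀ j → SignRow (sumRow k j)
      sumRow-sign j = assemble-entries 1ℤ _ _ _ _ {P = IsSign} 1± (unit-sign j -1±) (unit-sign j -1±)
        (λ _ → 0±) (unit-sign (bit k j) 1±)
      diffRow-sign : ∀ j → SignRow (diffRow k j)
      diffRow-sign j = assemble-entries 0ℤ _ _ _ _ {P = IsSign} 0± (unit-sign j -1±) (unit-sign j 1±)
        (unit-sign j -1±) (λ _ → 0±)
      lift-sign : ∀ {r} → (∀ c → IsSign (r c)) → SignRow (lift r)
      lift-sign r-sign zero        = 0±
      lift-sign {r} r-sign (suc c) = all-++⁺ {P = IsSign} {u = zeros} {v = r} (λ _ → 0±) r-sign c

  feasible⇒Bit : ∀ {m n} (M : Fin m → Fin n → ℤ) {x} → Feasible M x → ∀ c → Bit (x c)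
  feasible⇒Bit _ (_ , bounds) c = bounds⇒Bit (proj₁ (bounds c)) (proj₂ (bounds c))

  feasible-suc⁻ : ∀ k x → Feasible (A (suc k)) x →
    (∀ j → sumRow k j · x ≡ 0ℤ) × (∀ j → diffRow k j · x ≡ 0ℤ) × Feasible (A k) (oldPart k x)
  feasible-suc⁻ k x (solves , bounds) =
    all-++⁻ˡ Solved (sumRow k) (diffRow k) gadgetRows , all-++⁻ʳ Solved (sumRow k) (diffRow k) gadgetRows ,
    (λ r → trans (sym (lift-· k (A k r) x)) (liftedRows r)) , (λ c → bounds (suc (gadgetCols k ↑ʳ c)))
    where
      Solved : Vector ℤ (cols (suc k)) → Set
      Solved row = row · x ≡ 0ℤ
      gadgetRows = all-++⁻ˡ Solved (sumRow k ++ diffRow k) (map lift (A k)) solves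
      liftedRows = all-++⁻ʳ Solved (sumRow k ++ diffRow k) (map lift (A k)) solves

  feasible-suc⁺ : ∀ k x → (∀ c → Bit (x c)) →
    (∀ j → sumRow k j · x ≡ 0ℤ) → (∀ j → diffRow k j · x ≡ 0ℤ) → (∀ r → A k r · oldPart k x ≡ 0ℤ) →
    Feasible (A (suc k)) x
  feasible-suc⁺ k x entries sums diffs olds =
    all-++⁺ {P = Solved} {u = sumRow k ++ diffRow k} {v = map lift (A k)}
      (all-++⁺ {P = Solved} {u = sumRow k} {v = diffRow k} sums diffs) (λ r → trans (lift-· k (A k r) x) (olds r)) ,
    (λ c → Bit⇒bounds (entries c))
    where
      Solved : Vector ℤ (cols (suc k)) → Set
      Solved row = row · x ≡ 0ℤ

  andPart-feasible : ∀ k x → Feasible (A (suc k)) x → ∀ j → andPart k x j ≡ head x * bits k (oldPart k x) j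
  andPart-feasible k x feasible j with feasible-suc⁻ k x feasible
  ... | sums , diffs , _ = equations⇒and (entry zero) (entry (suc (gadgetCols k ↑ʳ bit k j)))
    (entry (suc ((j ↑ˡ (k ℕ.+ k)) ↑ˡ cols k))) (entry (suc ((k ↑ʳ (k ↑ʳ j)) ↑ˡ cols k)))
    (trans (sym (sumRow-· k j x)) (sums j)) (trans (sym (diffRow-· k j x)) (diffs j))
    where entry = feasible⇒Bit (A (suc k)) feasible

  W₀ W₁ : ∀ k → Vector ℕ (cols k)
  W₀ zero    = []
  W₀ (suc k) = 1 ∷ (replicate (gadgetCols k) 0 ++ map (2 ℕ.*_) (W₀ k))
  W₁ zero    = []
  W₁ (suc k) = 1 ∷ ((map (4 ℕ.*_) (twoPowers k) ++ replicate (k ℕ.+ k) 0) ++ map (4 ℕ.*_) (W₁ k))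

  W : ∀ k → Fin 2 → Fin (cols k) → ℕ
  W k = W₀ k ∷ (W₁ k ∷ [])

  ⟪W₀⟫-suc : ∀ k x → ⟪ W₀ (suc k) , x ⟫ ≡ head x + + 2 * ⟪ W₀ k , oldPart k x ⟫
  ⟪W₀⟫-suc k x = cong₂ _+_ (*-identityˡ (head x)) (begin
    ⟪ replicate (gadgetCols k) 0 ++ map (2 ℕ.*_) (W₀ k) , tail x ⟫
      ≡⟨ ⟪⟫-++ (replicate (gadgetCols k) 0) (map (2 ℕ.*_) (W₀ k)) (tail x) ⟩
    ⟪ replicate (gadgetCols k) 0 , gadgetPart k x ⟫ + ⟪ map (2 ℕ.*_) (W₀ k) , oldPart k x ⟫
      ≡⟨ cong₂ _+_ (zeros-· (gadgetPart k x)) (⟪⟫-map-* 2 (W₀ k) (oldPart k x)) ⟩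
    0ℤ + + 2 * ⟪ W₀ k , oldPart k x ⟫
      ≡⟨ +-identityˡ _ ⟩
    + 2 * ⟪ W₀ k , oldPart k x ⟫ ∎)

  ⟪W₁⟫-suc : ∀ k x → ⟪ W₁ (suc k) , x ⟫ ≡ head x + (+ 4 * binary (andPart k x) + + 4 * ⟪ W₁ k , oldPart k x ⟫)
  ⟪W₁⟫-suc k x = cong₂ _+_ (*-identityˡ (head x)) (begin
    ⟪ (map (4 ℕ.*_) (twoPowers k) ++ replicate (k ℕ.+ k) 0) ++ map (4 ℕ.*_) (W₁ k) , tail x ⟫
      ≡⟨ ⟪⟫-++ (map (4 ℕ.*_) (twoPowers k) ++ replicate (k ℕ.+ k) 0) (map (4 ℕ.*_) (W₁ k)) (tail x) ⟩
    ⟪ map (4 ℕ.*_) (twoPowers k) ++ replicate (k ℕ.+ k) 0 , gadgetPart k x ⟫ + ⟪ map (4 ℕ.*_) (W₁ k) , oldPart k x ⟫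
      ≡⟨ cong₂ _+_ (⟪⟫-++ (map (4 ℕ.*_) (twoPowers k)) (replicate (k ℕ.+ k) 0) (gadgetPart k x))
                   (⟪⟫-map-* 4 (W₁ k) (oldPart k x)) ⟩
    (⟪ map (4 ℕ.*_) (twoPowers k) , andPart k x ⟫ + ⟪ replicate (k ℕ.+ k) 0 , drop k (gadgetPart k x) ⟫)
      + + 4 * ⟪ W₁ k , oldPart k x ⟫
      ≡⟨ cong (_+ + 4 * ⟪ W₁ k , oldPart k x ⟫)
           (trans (cong₂ _+_ (⟪⟫-map-* 4 (twoPowers k) (andPart k x)) (zeros-· (drop k (gadgetPart k x))))
                  (+-identityʳ (+ 4 * binary (andPart k x)))) ⟩
    + 4 * binary (andPart k x) + + 4 * ⟪ W₁ k , oldPart k x ⟫ ∎)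

  ⟪W₀⟫≡binary : ∀ k x → ⟪ W₀ k , x ⟫ ≡ binary (bits k x)
  ⟪W₀⟫≡binary zero    x = refl
  ⟪W₀⟫≡binary (suc k) x = begin
    ⟪ W₀ (suc k) , x ⟫                                ≡⟨ ⟪W₀⟫-suc k x ⟩
    head x + + 2 * ⟪ W₀ k , oldPart k x ⟫             ≡⟨ cong (λ z → head x + + 2 * z) (⟪W₀⟫≡binary k (oldPart k x)) ⟩
    head x + + 2 * binary (bits k (oldPart k x))      ≡⟨ binary-∷ (bits (suc k) x) ⟨
    binary (bits (suc k) x)                           ∎

  ⟪W₁⟫≡square : ∀ k x → Feasible (A k) x → ⟪ W₁ k , x ⟫ ≡ ⟪ W₀ k , x ⟫ * ⟪ W₀ k , x ⟫
  ⟪W₁⟫≡square zero    x _        = refl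
  ⟪W₁⟫≡square (suc k) x feasible = begin
    ⟪ W₁ (suc k) , x ⟫                                 ≡⟨ ⟪W₁⟫-suc k x ⟩
    a + (+ 4 * binary (andPart k x) + + 4 * ⟪ W₁ k , oldPart k x ⟫)
      ≡⟨ cong₂ (λ p q → a + (+ 4 * p + + 4 * q)) carries (⟪W₁⟫≡square k (oldPart k x) oldFeasible) ⟩
    a + (+ 4 * (a * τ) + + 4 * (τ * τ))                ≡⟨ cong (λ z → z + (+ 4 * (a * τ) + + 4 * (τ * τ))) (Bit-idem a-bit) ⟨
    a * a + (+ 4 * (a * τ) + + 4 * (τ * τ))            ≡⟨ square a τ ⟩
    (a + + 2 * τ) * (a + + 2 * τ)                      ≡⟨ cong₂ _*_ (⟪W₀⟫-suc k x) (⟪W₀⟫-suc k x) ⟨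
    ⟪ W₀ (suc k) , x ⟫ * ⟪ W₀ (suc k) , x ⟫            ∎
    where
      a = head x
      τ = ⟪ W₀ k , oldPart k x ⟫
      a-bit = feasible⇒Bit (A (suc k)) feasible zero
      oldFeasible = proj₂ (proj₂ (feasible-suc⁻ k x feasible))
      carries : binary (andPart k x) ≡ a * τ
      carries = begin
        binary (andPart k x)                 ≡⟨ ·-congʳ (map +_ (twoPowers k)) (andPart-feasible k x feasible) ⟩
        binary (map (a *_) (bits k (oldPart k x))) ≡⟨ ·-map-* (map +_ (twoPowers k)) a (bits k (oldPart k x)) ⟩
        a * binary (bits k (oldPart k x))    ≡⟨ cong (a *_) (⟪W₀⟫≡binary k (oldPart k x)) ⟨
        a * τ                                ∎
      square : ∀ a τ → a * a + (+ 4 * (a * τ) + + 4 * (τ * τ)) ≡ (a + + 2 * τ) * (a + + 2 * τ)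
      square = solve-∀

  solution : ∀ k → Vector ℤ k → Vector ℤ (cols k)
  solution zero    b = []
  solution (suc k) b = assemble a (map (a *_) b′) (map (or a) b′) (map (xor a) b′) (solution k b′)
    where
      a = head b
      b′ = tail b

  bits-solution : ∀ k b j → bits k (solution k b) j ≡ b j
  bits-solution (suc k) b zero    = refl
  bits-solution (suc k) b (suc j) =
    trans (oldPart-assemble a (map (a *_) b′) (map (or a) b′) (map (xor a) b′) (solution k b′) (bit k j))
          (bits-solution k b′ j)
    where
      a = head b
      b′ = tail b

  solution-feasible : ∀ k b → (∀ i → Bit (b i)) → Feasible (A k) (solution k b)
  solution-feasible zero    b _     = (λ ()) , (λ ())
  solution-feasible (suc k) b b-bit = feasible-suc⁺ k x entries sums diffs olds
    where
      a = head b
      b′ = tail b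
      y w s : Vector ℤ k
      y = map (a *_) b′
      w = map (or a) b′
      s = map (xor a) b′
      x = solution (suc k) b
      oldFeasible = solution-feasible k b′ (λ i → b-bit (suc i))
      b′-bit : ∀ i → Bit (b′ i)
      b′-bit i = b-bit (suc i)
      entries : ∀ c → Bit (x c)
      entries = assemble-entries a y w s (solution k b′) {P = Bit} (b-bit zero)
        (λ j → Bit-* (b-bit zero) (b′-bit j)) (λ j → Bit-or (b-bit zero) (b′-bit j)) (λ j → Bit-xor (b-bit zero) (b′-bit j))
        (feasible⇒Bit (A k) oldFeasible)
      sums : ∀ j → sumRow k j · x ≡ 0ℤ
      sums j = trans (sumRow-· k j x)
        (trans (cong₂ (λ c p → a + c - p)
                  (trans (oldPart-assemble a y w s _ (bit k j)) (bits-solution k b′ j))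
                  (cong₂ _+_ (andPart-assemble a y w s _ j) (orPart-assemble a y w s _ j)))
               (sum-and-or a (b′ j)))
      diffs : ∀ j → diffRow k j · x ≡ 0ℤ
      diffs j = trans (diffRow-· k j x)
        (trans (cong₂ (λ p q → p - q) (orPart-assemble a y w s _ j)
                  (cong₂ _+_ (andPart-assemble a y w s _ j) (xorPart-assemble a y w s _ j)))
               (or-and-xor a (b′ j)))
      olds : ∀ r → A k r · oldPart k x ≡ 0ℤ
      olds r = trans (·-congʳ (A k r) (oldPart-assemble a y w s _)) (proj₁ oldFeasible r)

  W₀-< : ∀ k c → W₀ k c ℕ.< 2 ^ k
  W₀-< (suc k) zero    = ℕ.*-monoʳ-≤ 2 (ℕ.m^n>0 2 k)
  W₀-< (suc k) (suc c) = all-++⁺ {P = ℕ._< 2 ^ suc k} {u = replicate (gadgetCols k) 0} {v = map (2 ℕ.*_) (W₀ k)}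
    (λ _ → ℕ.m^n>0 2 (suc k)) (λ c → ℕ.*-monoʳ-< 2 (W₀-< k c)) c

  W₁-< : ∀ k c → W₁ k c ℕ.< 4 ^ k
  W₁-< (suc k) zero    = ℕ.≤-trans (ℕ.s≤s (ℕ.s≤s ℕ.z≤n)) (ℕ.*-monoʳ-≤ 4 (ℕ.m^n>0 4 k))
  W₁-< (suc k) (suc c) =
    all-++⁺ {P = ℕ._< 4 ^ suc k} {u = map (4 ℕ.*_) (twoPowers k) ++ replicate (k ℕ.+ k) 0} {v = map (4 ℕ.*_) (W₁ k)}
      (all-++⁺ {P = ℕ._< 4 ^ suc k} {u = map (4 ℕ.*_) (twoPowers k)} {v = replicate (k ℕ.+ k) 0}
        (λ j → ℕ.*-monoʳ-< 4 (ℕ.<-≤-trans (twoPowers-< k j) (ℕ.^-monoˡ-≤ k (ℕ.s≤s (ℕ.s≤s ℕ.z≤n)))))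
        (λ _ → ℕ.m^n>0 4 (suc k)))
      (λ c → ℕ.*-monoʳ-< 4 (W₁-< k c)) c

  W-< : ∀ k i c → W k i c ℕ.< 2 ^ (2 ℕ.* k)
  W-< k zero       c = ℕ.<-≤-trans (W₀-< k c) (ℕ.^-monoʳ-≤ 2 (ℕ.m≤n*m k 2))
  W-< k (suc zero) c = subst (W₁ k c ℕ.<_) (ℕ.^-*-assoc 2 2 k) (W₁-< k c)

  project-feasible : ∀ k x → Feasible (A k) x → project (W k) x ≡ parabola (binary (bits k x))
  project-feasible k x feasible =
    cong₂ _,_ (⟪W₀⟫≡binary k x) (trans (⟪W₁⟫≡square k x feasible) (cong₂ _*_ (⟪W₀⟫≡binary k x) (⟪W₀⟫≡binary k x)))

  feasible-on-parabola : ∀ k x → Feasible (A k) x → ∃[ t ] (t ℕ.< 2 ^ k × project (W k) x ≡ parabola (+ t))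
  feasible-on-parabola k x feasible with binary-< (bits k x) (λ j → feasible⇒Bit (A k) feasible (bit k j))
  ... | t , binary≡t , t<2ᵏ = t , t<2ᵏ , trans (project-feasible k x feasible) (cong parabola binary≡t)

  parabola-covered : ∀ k t → t ℕ.< 2 ^ k → ∃[ x ] (Feasible (A k) x × project (W k) x ≡ parabola (+ t))
  parabola-covered k t t<2ᵏ = x , feasible ,
    trans (project-feasible k x feasible)
          (cong parabola (trans (·-congʳ (map +_ (twoPowers k)) (bits-solution k b)) (binary-digits k t t<2ᵏ)))
    where
      b = digits k t
      x = solution k b
      feasible = solution-feasible k b (digits-Bit k t)


open import Data.Nat using (ℕ; _<_; _≤_; _*_; _^_; suc; _+_; z≤n; s≤s)
import Data.Nat.Properties as ℕ
open import Data.Nat.Tactic.RingSolver using (solve-∀)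
open import Data.Integer using (ℤ)
open import Data.Fin using (Fin)
open import Data.Product using (_×_; ∃-syntax; _,_)
open import Function.Definitions using (Injective)
open import Function.Bundles using (_⇔_)
open import Relation.Binary.PropositionalEquality
open import Defs using (SignMatrix; IsVertex)
open Parabola using (parabola-injective; parabola-vertices)
open Construction using (rows; cols; A-sign; W-<; feasible-on-parabola; parabola-covered)

rows+k : ∀ k → rows k + k ≡ k * k
rows+k 0       = refl
rows+k (suc k) = begin
  (k + k + rows k) + suc k   ≡⟨ regroup k (rows k) ⟩
  (k + k + 1) + (rows k + k) ≡⟨ cong ((k + k + 1) +_) (rows+k k) ⟩
  (k + k + 1) + k * k        ≡⟨ expand k ⟩
  suc k * suc k              ∎
  where
    open ≡-Reasoning
    regroup : ∀ k r → (k + k + r) + (1 + k) ≡ (k + k + 1) + (r + k)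
    regroup = solve-∀
    expand : ∀ k → (k + k + 1) + k * k ≡ (1 + k) * (1 + k)
    expand = solve-∀

2cols+k : ∀ k → 2 * cols k + k ≡ 3 * (k * k)
2cols+k 0       = refl
2cols+k (suc k) = begin
  2 * suc (k + (k + k) + cols k) + suc k ≡⟨ regroup k (cols k) ⟩
  3 + 6 * k + (2 * cols k + k)           ≡⟨ cong ((3 + 6 * k) +_) (2cols+k k) ⟩
  3 + 6 * k + 3 * (k * k)                ≡⟨ expand k ⟩
  3 * (suc k * suc k)                    ∎
  where
    open ≡-Reasoning
    regroup : ∀ k c → 2 * (1 + (k + (k + k) + c)) + (1 + k) ≡ 3 + 6 * k + (2 * c + k)
    regroup = solve-∀
    expand : ∀ k → 3 + 6 * k + 3 * (k * k) ≡ 3 * ((1 + k) * (1 + k))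
    expand = solve-∀

rows< : ∀ {k} → 1 ≤ k → rows k < 2 * (k * k)
rows< {k} 1≤k = ℕ.<-≤-trans (ℕ.m<m+n (rows k) 1≤k) (ℕ.≤-trans (ℕ.≤-reflexive (rows+k k)) (ℕ.m≤n*m (k * k) 2))

cols< : ∀ {k} → 1 ≤ k → cols k < 2 * (k * k)
cols< {k} 1≤k = ℕ.*-cancelˡ-< 2 (cols k) (2 * (k * k)) (begin-strict
  2 * cols k          <⟨ ℕ.m<m+n (2 * cols k) 1≤k ⟩
  2 * cols k + k      ≡⟨ 2cols+k k ⟩
  3 * (k * k)         ≤⟨ ℕ.*-monoˡ-≤ (k * k) {3} {4} (s≤s (s≤s (s≤s z≤n))) ⟩
  4 * (k * k)         ≡⟨ ℕ.*-assoc 2 2 (k * k) ⟩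
  2 * (2 * (k * k))   ∎)
  where open ℕ.≤-Reasoning

theorem3p2 : (k : ℕ) → 1 ≤ k →
    ∃[ m ] ∃[ n ] (m < 2 * (k * k) × n < 2 * (k * k)
      × ∃[ A ] (SignMatrix {m} {n} A
      × ∃[ W ] ((∀ i j → W i j < 2 ^ (2 * k))
      × ∃[ v ] (Injective {A = Fin (2 ^ k)} {B = ℤ × ℤ} _≡_ _≡_ v
      × (∀ p → IsVertex A W p ⇔ (∃[ i ] v i ≡ p))))))
theorem3p2 k 1≤k =
  rows k , cols k , rows< 1≤k , cols< 1≤k ,
  Construction.A k , A-sign k ,
  Construction.W k , W-< k ,
  _ , parabola-injective ,
  parabola-vertices (Construction.A k) (Construction.W k) (2 ^ k) (feasible-on-parabola k) (parabola-covered k)
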